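{- Neither $\Gamma_1$ nor $\Gamma_2$ contains an even subdivision of $K_{3,3}$ as a subgraph.
   Context: $\Gamma_1$ has vertices $a,\dots,l$ and edges $ab,bc,cd,de,ef,fg,gh,hi,ij,jk,kl,la,ad,je,bg,hk,ic,fl$. $\Gamma_2$ has vertices $a,\dots,l$ and edges $ab,bc,cd,de,ef,fg,gh,hi,ij,jk,kl,la,el,hd,kg,ai,fb,cj$. An edge subdivision replaces an edge $vw$ by a path from $v$ to $w$ with new internal vertices; it is even if the path has odd length. An even subdivision of $G$ is a graph obtained from $G$ by a finite sequence of (at least one) even edge subdivisions. -}

module Defs where

open import Data.Nat using (ℕ; zero; suc; _+_; _<_; _≤_)
open import Data.Fin using (Fin; toℕ; _↑ˡ_; _↑ʳ_; #_)
open import Data.Product using (Σ; _×_; _,_)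
open import Data.Sum using (_⊎_)
open import Data.List using (List; []; _∷_)
open import Data.List.Membership.Propositional using (_∈_)
open import Relation.Binary.PropositionalEquality using (_≡_)
open import Relation.Nullary using (¬_)
open import Function.Definitions using (Injective)

-- A finite graph: vertex set Fin V, edge relation E (read symmetrically).
record Graph : Set₁ where
  field
    V : ℕ
    E : Fin V → Fin V → Set
open Graph public

fromEdges : (n : ℕ) → List (Fin n × Fin n) → Graph
fromEdges n es = record { V = n ; E = λ x y → ((x , y) ∈ es) ⊎ ((y , x) ∈ es) }

K33 : Graph
K33 = record { V = 6 ; E = λ x y → (toℕ x < 3 × 3 ≤ toℕ y) ⊎ (toℕ y < 3 × 3 ≤ toℕ x) }

-- Even edge subdivision: replace the edge u–v by a path
-- u, w₀, w₁, …, w_{m-1}, v  with m = 2k+2 new internal vertices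
-- (path length 2k+3, an odd length ≥ 3). New vertices are V ↑ʳ i.
module _ (G : Graph) (u v : Fin (V G)) (k : ℕ) where
  private
    m : ℕ
    m = suc (suc (k + k))

  data SubE : Fin (V G + m) → Fin (V G + m) → Set where
    old   : ∀ {a b} → E G a b → ¬ (a ≡ u × b ≡ v) → ¬ (a ≡ v × b ≡ u) →
            SubE (a ↑ˡ m) (b ↑ˡ m)
    start : ∀ (i : Fin m) → toℕ i ≡ 0 → SubE (u ↑ˡ m) (V G ↑ʳ i)
    step  : ∀ (i j : Fin m) → toℕ j ≡ suc (toℕ i) → SubE (V G ↑ʳ i) (V G ↑ʳ j)
    end   : ∀ (i : Fin m) → suc (toℕ i) ≡ m → SubE (V G ↑ʳ i) (v ↑ˡ m)
    flip  : ∀ {x y} → SubE x y → SubE y x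

  subdivide : Graph
  subdivide = record { V = V G + m ; E = SubE }

data EvenSubdivision (G : Graph) : Graph → Set₁ where
  once : ∀ u v k → E G u v → EvenSubdivision G (subdivide G u v k)
  more : ∀ {H} → EvenSubdivision G H → ∀ u v k → E H u v →
         EvenSubdivision G (subdivide H u v k)

ContainsSubgraph : Graph → Graph → Set
ContainsSubgraph Γ H =
  Σ (Fin (V H) → Fin (V Γ)) λ f →
    Injective _≡_ _≡_ f × (∀ x y → E H x y → E Γ (f x) (f y))

ContainsEvenSubdivisionOf : Graph → Graph → Set₁
ContainsEvenSubdivisionOf Γ G = Σ Graph λ H → EvenSubdivision G H × ContainsSubgraph Γ H

-- vertices a,…,l are 0,…,11
Γ₁ : Graph
Γ₁ = fromEdges 12
  ( (# 0 , # 1) ∷ (# 1 , # 2) ∷ (# 2 , # 3) ∷ (# 3 , # 4) ∷ (# 4 , # 5) ∷ (# 5 , # 6)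
  ∷ (# 6 , # 7) ∷ (# 7 , # 8) ∷ (# 8 , # 9) ∷ (# 9 , # 10) ∷ (# 10 , # 11) ∷ (# 11 , # 0)
  ∷ (# 0 , # 3) ∷ (# 9 , # 4) ∷ (# 1 , # 6) ∷ (# 7 , # 10) ∷ (# 8 , # 2) ∷ (# 5 , # 11) ∷ [])

Γ₂ : Graph
Γ₂ = fromEdges 12
  ( (# 0 , # 1) ∷ (# 1 , # 2) ∷ (# 2 , # 3) ∷ (# 3 , # 4) ∷ (# 4 , # 5) ∷ (# 5 , # 6)
  ∷ (# 6 , # 7) ∷ (# 7 , # 8) ∷ (# 8 , # 9) ∷ (# 9 , # 10) ∷ (# 10 , # 11) ∷ (# 11 , # 0)
  ∷ (# 4 , # 11) ∷ (# 7 , # 3) ∷ (# 10 , # 6) ∷ (# 0 , # 8) ∷ (# 5 , # 1) ∷ (# 2 , # 9) ∷ [])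

{-# OPTIONS --safe #-}

-- Undoing the subdivisions one edge at a time turns an even subdivision of K₃,₃ in Γ into six
-- branch vertices of Γ joined by nine internally disjoint paths, each with an even number of
-- interior vertices: the paths that replace a subdivided edge uv are concatenated along the
-- 2k + 2 new vertices of its chain, so the parities add up to an even number again.  Such a
-- configuration would be found by a depth-first search that places one branch vertex and then
-- grows the nine paths in a fixed order, remembering only the parity of the current path.  The
-- search is complete, and on Γ₁ and Γ₂ it finds nothing.

module Submission where

open import Defs
open import Data.Product using (_×_)
open import Relation.Nullary using (¬_)

open import Data.Bool using (Bool; true; false; not; _∧_; _∨_; T)
open import Data.Bool.Properties using (T-∧; T-∨)
open import Data.Empty using (⊥-elim)
open import Data.Fin using (Fin; zero; suc; toℕ; fromℕ; inject₁; splitAt; _↑ˡ_; _↑ʳ_; #_; _≟_)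
open import Data.Fin.Properties
  using (toℕ-injective; toℕ<n; toℕ-inject₁; toℕ-fromℕ; toℕ-↑ˡ; toℕ-↑ʳ; ↑ˡ-injective; ↑ʳ-injective;
         splitAt-↑ˡ; splitAt-↑ʳ; pigeonhole)
import Data.Fin.Properties as Fin
open import Data.List
  using (List; []; _∷_; _++_; _∷ʳ_; _ʳ++_; length; map; reverse; tabulate; lookup; upTo; concatMap)
open import Data.List.Properties
  using (length-++; length-reverse; length-tabulate; unfold-reverse; map-concatMap)
open import Data.List.Membership.Propositional using (_∈_; _∉_)
open import Data.List.Membership.Propositional.Properties using (∈-++⁻; ∈-tabulate⁻; ∈-upTo⁺; ∈-lookup)
open import Data.List.Relation.Unary.Any using (here; there; any?)
open import Data.List.Relation.Unary.Any.Properties using (reverse⁻)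
open import Data.List.Relation.Unary.All as All using (All; []; _∷_; all?)
open import Data.List.Relation.Unary.All.Properties using (¬Any⇒All¬) renaming (map⁺ to All-map⁺)
open import Data.List.Relation.Unary.AllPairs as AllPairs using (AllPairs; []; _∷_; allPairs?)
open import Data.List.Relation.Unary.AllPairs.Properties using () renaming (map⁺ to AllPairs-map⁺)
open import Data.List.Relation.Unary.Unique.Propositional using (Unique)
open import Data.List.Relation.Unary.Unique.Propositional.Properties
  using (++⁺; map⁺; tabulate⁺; concat⁺; Unique[x∷xs]⇒x∉xs)
open import Data.List.Relation.Binary.Disjoint.Propositional using (Disjoint)
open import Data.List.Relation.Binary.Permutation.Setoid using (↭-sym)
open import Data.List.Relation.Binary.Permutation.Setoid.Properties using (Unique-resp-↭; ↭-reverse)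
open import Data.Nat using (ℕ; zero; suc; _+_; _<_; _≤_; s≤s; _≤?_; _≡ᵇ_; parity)
import Data.Nat as ℕ
open import Data.Nat.Properties using (≡ᵇ⇒≡; ≡⇒≡ᵇ; <⇒≱; ≰⇒>; m≤m+n; 1+n≢n)
open import Data.Parity.Base as ℙ using (Parity; 0ℙ; _⁻¹)
open import Data.Parity.Properties using (+-homo-+; suc-homo-⁻¹; p+p≡0ℙ)
import Data.Parity.Properties as ℙ
open import Data.Product using (_,_; proj₁; proj₂)
import Data.Product as Product
open import Data.Sum using (_⊎_; inj₁; inj₂)
import Data.Sum as Sum
open import Data.Unit using (⊤; tt)
open import Data.Vec.Functional using (Vector; updateAt)
open import Data.Vec.Functional.Properties using (updateAt-updates; updateAt-minimal)
open import Function using (_∘_; const)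
open import Function.Bundles using (Equivalence)
open import Function.Definitions using (Injective)
open import Relation.Binary.Definitions using (Symmetric; Decidable)
open import Relation.Binary.PropositionalEquality
  using (_≡_; _≢_; refl; sym; trans; cong; subst; subst₂; setoid; module ≡-Reasoning)
open import Relation.Nullary using (Dec; yes; no; does; contradiction; ¬?)
open import Relation.Nullary.Decidable using (True; toWitness; map′; _×-dec_; from-yes)

-- Walks and loopless graphs

data Walk (G : Graph) : Fin (V G) → List (Fin (V G)) → Fin (V G) → Set where
  [_] : ∀ {a b} → E G a b → Walk G a [] b
  _∷_ : ∀ {a c l b} → E G a c → Walk G c l b → Walk G a (c ∷ l) b

module _ {G : Graph} where

  Walk-++ : ∀ {a l b l′ c} → Walk G a l b → Walk G b l′ c → Walk G a (l ++ b ∷ l′) c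
  Walk-++ [ e ]   w′ = e ∷ w′
  Walk-++ (e ∷ w) w′ = e ∷ Walk-++ w w′

  Walk-reverse : Symmetric (E G) → ∀ {a l b} → Walk G a l b → Walk G b (reverse l) a
  Walk-reverse E-sym [ e ] = [ E-sym e ]
  Walk-reverse E-sym {a} {c ∷ l} {b} (e ∷ w) =
    subst (λ l′ → Walk G b l′ a) (sym (unfold-reverse c l)) (Walk-++ (Walk-reverse E-sym w) [ E-sym e ])

  Walk-tabulate : ∀ {n b} (f : Fin (suc n) → Fin (V G)) →
                  (∀ i → E G (f (inject₁ i)) (f (suc i))) → E G (f (fromℕ n)) b →
                  Walk G (f zero) (tabulate (f ∘ suc)) b
  Walk-tabulate {zero}  f steps last = [ last ]
  Walk-tabulate {suc n} f steps last = steps zero ∷ Walk-tabulate (f ∘ suc) (steps ∘ suc) last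

Loopless : Graph → Set
Loopless G = ∀ {x y} → E G x y → x ≢ y

↑ˡ≢↑ʳ : ∀ {m n} (i : Fin m) (j : Fin n) → i ↑ˡ n ≢ m ↑ʳ j
↑ˡ≢↑ʳ {m} {n} i j eq =
  contradiction (trans (sym (splitAt-↑ˡ m i n)) (trans (cong (splitAt m) eq) (splitAt-↑ʳ m n j))) λ ()

subdivide-loopless : ∀ {H u v k} → Loopless H → Loopless (subdivide H u v k)
subdivide-loopless H-loopless (old e _ _)       = H-loopless e ∘ ↑ˡ-injective _ _ _
subdivide-loopless _          (start i _)       = ↑ˡ≢↑ʳ _ i
subdivide-loopless _          (step i j j≡1+i) =
  λ eq → 1+n≢n (sym (trans (cong toℕ (↑ʳ-injective _ i j eq)) j≡1+i))
subdivide-loopless _          (end i _)         = ↑ˡ≢↑ʳ _ i ∘ sym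
subdivide-loopless H-loopless (flip e)          = subdivide-loopless H-loopless e ∘ sym

evenSubdivision-loopless : ∀ {G H} → Loopless G → EvenSubdivision G H → Loopless H
evenSubdivision-loopless G-loopless (once u v k _)   = subdivide-loopless G-loopless
evenSubdivision-loopless G-loopless (more d u v k _) =
  subdivide-loopless (evenSubdivision-loopless G-loopless d)

K33-loopless : Loopless K33
K33-loopless (inj₁ (x<3 , 3≤y)) refl = <⇒≱ x<3 3≤y
K33-loopless (inj₂ (y<3 , 3≤x)) refl = <⇒≱ y<3 3≤x

Unique-reverse : ∀ {A : Set} {xs : List A} → Unique xs → Unique (reverse xs)
Unique-reverse {xs = xs} = Unique-resp-↭ (setoid _) (↭-sym (setoid _) (↭-reverse (setoid _) xs))

-- Odd models

-- A copy of an even subdivision of G inside Γ: the edge xy of G becomes a path of Γ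
-- whose interior vertices are listed, in order, by interior x y, an even number of them.
record OddModel (Γ G : Graph) : Set where
  field
    branch            : Fin (V G) → Fin (V Γ)
    interior          : Fin (V G) → Fin (V G) → List (Fin (V Γ))
    branch-injective  : Injective _≡_ _≡_ branch
    interior-walk     : ∀ {x y} → E G x y → Walk Γ (branch x) (interior x y) (branch y)
    interior-even     : ∀ {x y} → E G x y → parity (length (interior x y)) ≡ 0ℙ
    interior-unique   : ∀ {x y} → E G x y → Unique (interior x y)
    branch∉interior   : ∀ {x y z} → E G x y → branch z ∉ interior x y
    interior-disjoint : ∀ {x y x′ y′ z} → E G x y → E G x′ y′ →
                        z ∈ interior x y → z ∈ interior x′ y′ → (x ≡ x′ × y ≡ y′) ⊎ (x ≡ y′ × y ≡ x′)

module _ {Γ : Graph} where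

  fromSubgraph : ∀ {H} → ContainsSubgraph Γ H → OddModel Γ H
  fromSubgraph (f , f-injective , f-edge) = record
    { branch            = f
    ; interior          = λ _ _ → []
    ; branch-injective  = f-injective
    ; interior-walk     = λ e → [ f-edge _ _ e ]
    ; interior-even     = λ _ → refl
    ; interior-unique   = λ _ → []
    ; branch∉interior   = λ _ ()
    ; interior-disjoint = λ _ _ ()
    }

  module Expansion {G : Graph} (M : OddModel Γ G) where
    open OddModel M

    expand : Fin (V G) → List (Fin (V G)) → Fin (V G) → List (Fin (V Γ))
    expand a []      b = interior a b
    expand a (c ∷ l) b = interior a c ++ branch c ∷ expand c l b

    expand-walk : ∀ {a l b} → Walk G a l b → Walk Γ (branch a) (expand a l b) (branch b)
    expand-walk [ e ]   = interior-walk e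
    expand-walk (e ∷ w) = Walk-++ (interior-walk e) (expand-walk w)

    expand-parity : ∀ {a l b} → Walk G a l b → parity (length (expand a l b)) ≡ parity (length l)
    expand-parity [ e ] = interior-even e
    expand-parity {a} {c ∷ l} {b} (e ∷ w) = begin
      parity (length (interior a c ++ branch c ∷ expand c l b))      ≡⟨ cong parity (length-++ (interior a c)) ⟩
      parity (length (interior a c) + suc (length (expand c l b)))   ≡⟨ +-homo-+ (length (interior a c)) _ ⟩
      parity (length (interior a c)) ℙ.+ parity (suc (length (expand c l b)))
                                                                     ≡⟨ cong (ℙ._+ _) (interior-even e) ⟩
      parity (suc (length (expand c l b)))                           ≡⟨ +-homo-+ 1 (length (expand c l b)) ⟩
      parity (length (expand c l b)) ⁻¹                              ≡⟨ cong _⁻¹ (expand-parity w) ⟩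
      parity (length l) ⁻¹                                           ≡⟨ +-homo-+ 1 (length l) ⟨
      parity (suc (length l))                                        ∎
      where open ≡-Reasoning

    data Origin (a : Fin (V G)) (l : List (Fin (V G))) (b : Fin (V G)) (z : Fin (V Γ)) : Set where
      on-edge   : ∀ {s t} → E G s t → s ∈ a ∷ l → t ∈ l ∷ʳ b → z ∈ interior s t → Origin a l b z
      at-branch : ∀ {c} → c ∈ l → z ≡ branch c → Origin a l b z

    expand-origin : ∀ {a l b z} → Walk G a l b → z ∈ expand a l b → Origin a l b z
    expand-origin [ e ] z∈ = on-edge e (here refl) (here refl) z∈
    expand-origin {a} (_∷_ {c = c} e w) z∈ with ∈-++⁻ (interior a c) z∈
    ... | inj₁ z∈ac          = on-edge e (here refl) (here refl) z∈ac
    ... | inj₂ (here z≡c)    = at-branch (here refl) z≡c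
    ... | inj₂ (there z∈rest) with expand-origin w z∈rest
    ...   | on-edge e′ s∈ t∈ z∈st = on-edge e′ (there s∈) (there t∈) z∈st
    ...   | at-branch c′∈ z≡c′    = at-branch (there c′∈) z≡c′

    expand-avoids : ∀ {a l b x} → Walk G a l b → x ∉ l → branch x ∉ expand a l b
    expand-avoids w x∉l x∈ with expand-origin w x∈
    ... | on-edge e _ _ x∈st  = branch∉interior e x∈st
    ... | at-branch c∈ x≡c   = x∉l (subst (_∈ _) (sym (branch-injective x≡c)) c∈)

    -- a ≢ b is needed: along a walk a, c, a the paths interior a c and interior c a may overlap.
    expand-unique : ∀ {a l b} → Walk G a l b → a ∉ l → b ∉ l → a ≢ b → Unique l → Unique (expand a l b)
    expand-unique [ e ] _ _ _ _ = interior-unique e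
    expand-unique {a} {c ∷ l} {b} (e ∷ w) a∉ b∉ a≢b cl-unique@(_ ∷ l-unique) =
      ++⁺ (interior-unique e)
          (¬Any⇒All¬ _ (expand-avoids w c∉l) ∷ expand-unique w c∉l (b∉ ∘ there) c≢b l-unique)
          separate
      where
      c∉l : c ∉ l
      c∉l = Unique[x∷xs]⇒x∉xs cl-unique

      c≢b : c ≢ b
      c≢b c≡b = b∉ (here (sym c≡b))

      a∉ends : a ∉ l ∷ʳ b
      a∉ends a∈ with ∈-++⁻ l a∈
      ... | inj₁ a∈l        = a∉ (there a∈l)
      ... | inj₂ (here a≡b) = a≢b a≡b

      separate : Disjoint (interior a c) (branch c ∷ expand c l b)
      separate (z∈ac , here refl) = branch∉interior e z∈ac
      separate (z∈ac , there z∈rest) with expand-origin w z∈rest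
      ... | at-branch _ refl = branch∉interior e z∈ac
      ... | on-edge e′ s∈ t∈ z∈st with interior-disjoint e e′ z∈ac z∈st
      ...   | inj₁ (refl , _) = a∉ s∈
      ...   | inj₂ (refl , _) = a∉ends t∈

  module Contraction (Γ-sym : Symmetric (E Γ)) {H : Graph} {u v : Fin (V H)} {k : ℕ} (u≢v : u ≢ v)
                     (M : OddModel Γ (subdivide H u v k)) where
    open OddModel M
    open Expansion M

    m : ℕ
    m = suc (suc (k + k))

    lift : Fin (V H) → Fin (V H + m)
    lift x = x ↑ˡ m

    lift-injective : Injective _≡_ _≡_ lift
    lift-injective = ↑ˡ-injective m _ _

    new : Fin m → Fin (V H + m)
    new i = V H ↑ʳ i

    chain : List (Fin (V H + m))
    chain = tabulate new

    chain-walk : Walk (subdivide H u v k) (lift u) chain (lift v)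
    chain-walk = start zero refl ∷ Walk-tabulate new
      (λ i → step (inject₁ i) (suc i) (cong suc (sym (toℕ-inject₁ i))))
      (end (fromℕ _) (cong suc (toℕ-fromℕ _)))

    chain-unique : Unique chain
    chain-unique = tabulate⁺ (↑ʳ-injective (V H) _ _)

    chain-even : parity (length chain) ≡ 0ℙ
    chain-even = begin
      parity (length chain)  ≡⟨ cong parity (length-tabulate new) ⟩
      parity (k + k)         ≡⟨ +-homo-+ k k ⟩
      parity k ℙ.+ parity k  ≡⟨ p+p≡0ℙ (parity k) ⟩
      0ℙ                     ∎
      where open ≡-Reasoning

    lift∉chain : ∀ {x} → lift x ∉ chain
    lift∉chain x∈ with i , x≡i ← ∈-tabulate⁻ x∈ = ↑ˡ≢↑ʳ _ i x≡i

    lift∈start : ∀ {x} → lift x ∈ lift u ∷ chain → x ≡ u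
    lift∈start (here x≡u)  = lift-injective x≡u
    lift∈start (there x∈) = contradiction x∈ lift∉chain

    lift∈end : ∀ {x} → lift x ∈ chain ∷ʳ lift v → x ≡ v
    lift∈end x∈ with ∈-++⁻ chain x∈
    ... | inj₁ x∈chain    = contradiction x∈chain lift∉chain
    ... | inj₂ (here x≡v) = lift-injective x≡v

    path : List (Fin (V Γ))
    path = expand (lift u) chain (lift v)

    path-unique : Unique path
    path-unique = expand-unique chain-walk lift∉chain lift∉chain (u≢v ∘ lift-injective) chain-unique

    path-avoids-old : ∀ {x y z} (e : E H x y) (¬uv : ¬ (x ≡ u × y ≡ v)) (¬vu : ¬ (x ≡ v × y ≡ u)) →
                      z ∈ path → z ∉ interior (lift x) (lift y)
    path-avoids-old e ¬uv ¬vu z∈path z∈xy with expand-origin chain-walk z∈path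
    ... | at-branch _ refl = branch∉interior (old e ¬uv ¬vu) z∈xy
    ... | on-edge e′ s∈ t∈ z∈st with interior-disjoint e′ (old e ¬uv ¬vu) z∈st z∈xy
    ...   | inj₁ (refl , refl) = ¬uv (lift∈start s∈ , lift∈end t∈)
    ...   | inj₂ (refl , refl) = ¬vu (lift∈end t∈ , lift∈start s∈)

    data Orientation (x y : Fin (V H)) : Set where
      forward  : x ≡ u → y ≡ v → Orientation x y
      backward : x ≡ v → y ≡ u → Orientation x y
      other    : ¬ (x ≡ u × y ≡ v) → ¬ (x ≡ v × y ≡ u) → Orientation x y

    orientation : ∀ x y → Orientation x y
    orientation x y with (x ≟ u) ×-dec (y ≟ v) | (x ≟ v) ×-dec (y ≟ u)
    ... | yes (x≡u , y≡v) | _               = forward x≡u y≡v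
    ... | no ¬uv          | yes (x≡v , y≡u) = backward x≡v y≡u
    ... | no ¬uv          | no ¬vu          = other ¬uv ¬vu

    interiorOf : ∀ {x y} → Orientation x y → List (Fin (V Γ))
    interiorOf (forward _ _)          = path
    interiorOf (backward _ _)         = reverse path
    interiorOf {x} {y} (other _ _)    = interior (lift x) (lift y)

    interior′ : Fin (V H) → Fin (V H) → List (Fin (V Γ))
    interior′ x y = interiorOf (orientation x y)

    interior′-walk : ∀ {x y} → E H x y → Walk Γ (branch (lift x)) (interior′ x y) (branch (lift y))
    interior′-walk {x} {y} e with orientation x y
    ... | forward refl refl  = expand-walk chain-walk
    ... | backward refl refl = Walk-reverse Γ-sym (expand-walk chain-walk)
    ... | other ¬uv ¬vu      = interior-walk (old e ¬uv ¬vu)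

    interior′-even : ∀ {x y} → E H x y → parity (length (interior′ x y)) ≡ 0ℙ
    interior′-even {x} {y} e with orientation x y
    ... | forward refl refl  = trans (expand-parity chain-walk) chain-even
    ... | backward refl refl =
      trans (cong parity (length-reverse path)) (trans (expand-parity chain-walk) chain-even)
    ... | other ¬uv ¬vu      = interior-even (old e ¬uv ¬vu)

    interior′-unique : ∀ {x y} → E H x y → Unique (interior′ x y)
    interior′-unique {x} {y} e with orientation x y
    ... | forward refl refl  = path-unique
    ... | backward refl refl = Unique-reverse path-unique
    ... | other ¬uv ¬vu      = interior-unique (old e ¬uv ¬vu)

    branch∉interior′ : ∀ {x y z} → E H x y → branch (lift z) ∉ interior′ x y
    branch∉interior′ {x} {y} e with orientation x y
    ... | forward refl refl  = expand-avoids chain-walk lift∉chain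
    ... | backward refl refl = expand-avoids chain-walk lift∉chain ∘ reverse⁻
    ... | other ¬uv ¬vu      = branch∉interior (old e ¬uv ¬vu)

    interior′-disjoint : ∀ {x y x′ y′ z} → E H x y → E H x′ y′ →
                         z ∈ interior′ x y → z ∈ interior′ x′ y′ → (x ≡ x′ × y ≡ y′) ⊎ (x ≡ y′ × y ≡ x′)
    interior′-disjoint {x} {y} {x′} {y′} e e′ z∈ z∈′ with orientation x y | orientation x′ y′
    ... | forward refl refl  | forward refl refl  = inj₁ (refl , refl)
    ... | forward refl refl  | backward refl refl = inj₂ (refl , refl)
    ... | backward refl refl | forward refl refl  = inj₂ (refl , refl)
    ... | backward refl refl | backward refl refl = inj₁ (refl , refl)
    ... | forward _ _        | other ¬uv ¬vu      = ⊥-elim (path-avoids-old e′ ¬uv ¬vu z∈ z∈′)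
    ... | backward _ _       | other ¬uv ¬vu      = ⊥-elim (path-avoids-old e′ ¬uv ¬vu (reverse⁻ z∈) z∈′)
    ... | other ¬uv ¬vu      | forward _ _        = ⊥-elim (path-avoids-old e ¬uv ¬vu z∈′ z∈)
    ... | other ¬uv ¬vu      | backward _ _       = ⊥-elim (path-avoids-old e ¬uv ¬vu (reverse⁻ z∈′) z∈)
    ... | other ¬uv ¬vu      | other ¬uv′ ¬vu′    =
      Sum.map lifted lifted (interior-disjoint (old e ¬uv ¬vu) (old e′ ¬uv′ ¬vu′) z∈ z∈′)
      where
      lifted : ∀ {a b c d} → lift a ≡ lift b × lift c ≡ lift d → a ≡ b × c ≡ d
      lifted = Product.map lift-injective lift-injective

    model : OddModel Γ H
    model = record
      { branch            = branch ∘ lift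
      ; interior          = interior′
      ; branch-injective  = lift-injective ∘ branch-injective
      ; interior-walk     = interior′-walk
      ; interior-even     = interior′-even
      ; interior-unique   = interior′-unique
      ; branch∉interior   = branch∉interior′
      ; interior-disjoint = interior′-disjoint
      }

  contract : Symmetric (E Γ) → ∀ {H u v k} → u ≢ v → OddModel Γ (subdivide H u v k) → OddModel Γ H
  contract Γ-sym u≢v M = Contraction.model Γ-sym u≢v M

  unsubdivide : Symmetric (E Γ) → ∀ {G H} → Loopless G → EvenSubdivision G H → OddModel Γ H → OddModel Γ G
  unsubdivide Γ-sym G-loopless (once u v k e) =
    contract Γ-sym (G-loopless e)
  unsubdivide Γ-sym G-loopless (more d u v k e) =
    unsubdivide Γ-sym G-loopless d ∘ contract Γ-sym (evenSubdivision-loopless G-loopless d e)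

  oddModel : Symmetric (E Γ) → ∀ {G} → Loopless G → ContainsEvenSubdivisionOf Γ G → OddModel Γ G
  oddModel Γ-sym G-loopless (H , H-even , H⊆Γ) = unsubdivide Γ-sym G-loopless H-even (fromSubgraph H⊆Γ)

-- Searching for odd models

-- Structural recursion rather than the library's or ∘ map: the search below is run by the
-- type checker, and this version evaluates markedly faster.
any : {A : Set} → (A → Bool) → List A → Bool
any p []       = false
any p (x ∷ xs) = p x ∨ any p xs

any-complete : ∀ {A : Set} {p : A → Bool} {x xs} → x ∈ xs → T (p x) → T (any p xs)
any-complete (here refl) px = Equivalence.from T-∨ (inj₁ px)
any-complete (there x∈) px = Equivalence.from T-∨ (inj₂ (any-complete x∈ px))

_∈ᵇ_ : ℕ → List ℕ → Bool
x ∈ᵇ xs = any (x ≡ᵇ_) xs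

∉⇒∉ᵇ : ∀ {x} xs → x ∉ xs → T (not (x ∈ᵇ xs))
∉⇒∉ᵇ []       _  = tt
∉⇒∉ᵇ {x} (y ∷ ys) x∉ with x ≡ᵇ y in x≡ᵇy
... | true  = x∉ (here (≡ᵇ⇒≡ x y (subst T (sym x≡ᵇy) tt)))
... | false = ∉⇒∉ᵇ ys (x∉ ∘ there)

lookup-injective : ∀ {A : Set} {xs : List A} → Unique xs → ∀ {i j} → lookup xs i ≡ lookup xs j → i ≡ j
lookup-injective {xs = _ ∷ _} _               {zero}  {zero}  _  = refl
lookup-injective {xs = _ ∷ _} (x≢xs ∷ _)      {zero}  {suc j} eq = ⊥-elim (All.lookup x≢xs (∈-lookup j) eq)
lookup-injective {xs = _ ∷ _} (x≢xs ∷ _)      {suc i} {zero}  eq =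
  ⊥-elim (All.lookup x≢xs (∈-lookup i) (sym eq))
lookup-injective {xs = _ ∷ _} (_ ∷ xs-unique) {suc i} {suc j} eq = cong suc (lookup-injective xs-unique eq)

Unique⇒length≤ : ∀ {n} {xs : List (Fin n)} → Unique xs → length xs ≤ n
Unique⇒length≤ {n} {xs} xs-unique with length xs ≤? n
... | yes fits = fits
... | no ¬fits with i , j , i<j , same ← pigeonhole (≰⇒> ¬fits) (lookup xs) =
  contradiction (lookup-injective xs-unique same) (Fin.<⇒≢ i<j)

-- A script for finding an odd model of G: grow x y e follows the edge e from the already
-- placed branch vertex x to a new one y, reach x y e to the already placed y.
data Move (G : Graph) : Set where
  grow reach : (x y : Fin (V G)) → E G x y → Move G

-- Vertices of Γ are handled as natural numbers, whose builtin equality _≡ᵇ_ keeps evaluation fast.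
module Search {G : Graph} (N : ℕ) (adjacency : ℕ → List ℕ) where

  -- explore f used cur p accept is true if some walk cur, w₁, …, wⱼ, w with j < f and parity j ≡ p,
  -- whose w₁, …, wⱼ are distinct and not in used, satisfies accept w (wⱼ ∷ … ∷ w₁ ∷ used).
  explore : ℕ → List ℕ → ℕ → Parity → (ℕ → List ℕ → Bool) → Bool
  explore zero    used cur p accept = false
  explore (suc f) used cur p accept = any visit (adjacency cur)
    where
    visit : ℕ → Bool
    visit w = (does (p ℙ.≟ 0ℙ) ∧ accept w used)
            ∨ (not (w ∈ᵇ used) ∧ explore f (w ∷ used) w (p ⁻¹) accept)

  run : List (Move G) → Vector ℕ (V G) → List ℕ → Bool
  run []                 σ used = true
  run (grow x y _ ∷ ms)  σ used = explore (suc N) used (σ x) 0ℙ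
    λ w used′ → not (w ∈ᵇ used′) ∧ run ms (updateAt σ y (const w)) (w ∷ used′)
  run (reach x y _ ∷ ms) σ used = explore (suc N) used (σ x) 0ℙ
    λ w used′ → (w ≡ᵇ σ y) ∧ run ms σ used′

  -- The placement σ starts constant: only the entry of the first branch vertex is meaningful,
  -- and a valid script never reads an entry before setting it.
  search : List (Move G) → Bool
  search ms = any (λ a → run ms (const a) (a ∷ [])) (upTo N)

data Valid {G : Graph} (D : List (Fin (V G))) : List (Move G) → Set where
  []    : Valid D []
  grow  : ∀ {x y e ms} → x ∈ D → Valid (y ∷ D) ms → Valid D (grow x y e ∷ ms)
  reach : ∀ {x y e ms} → x ∈ D → y ∈ D → Valid D ms → Valid D (reach x y e ∷ ms)

valid? : ∀ {G} D (ms : List (Move G)) → Dec (Valid D ms)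
valid? D [] = yes []
valid? D (grow x y e ∷ ms) =
  map′ (λ (x∈ , rest) → grow x∈ rest) (λ { (grow x∈ rest) → x∈ , rest })
       (any? (x ≟_) D ×-dec valid? (y ∷ D) ms)
valid? D (reach x y e ∷ ms) =
  map′ (λ (x∈ , y∈ , rest) → reach x∈ y∈ rest) (λ { (reach x∈ y∈ rest) → x∈ , y∈ , rest })
       (any? (x ≟_) D ×-dec any? (y ≟_) D ×-dec valid? D ms)

data Atom (G : Graph) : Set where
  vertex : Fin (V G) → Atom G
  path   : ∀ x y → E G x y → Atom G

atoms : ∀ {G} → List (Move G) → List (Atom G)
atoms []                 = []
atoms (grow x y e ∷ ms)  = path x y e ∷ vertex y ∷ atoms ms
atoms (reach x y e ∷ ms) = path x y e ∷ atoms ms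

Separated : ∀ {G} → Atom G → Atom G → Set
Separated (vertex x)     (vertex y)       = x ≢ y
Separated (vertex _)     (path _ _ _)     = ⊤
Separated (path _ _ _)   (vertex _)       = ⊤
Separated (path x y _)   (path x′ y′ _)   = ¬ (x ≡ x′ × y ≡ y′) × ¬ (x ≡ y′ × y ≡ x′)

separated? : ∀ {G} → Decidable (Separated {G})
separated? (vertex x)   (vertex y)     = ¬? (x ≟ y)
separated? (vertex _)   (path _ _ _)   = yes tt
separated? (path _ _ _) (vertex _)     = yes tt
separated? (path x y _) (path x′ y′ _) = ¬? ((x ≟ x′) ×-dec (y ≟ y′)) ×-dec ¬? ((x ≟ y′) ×-dec (y ≟ x′))

data Fresh (used : List ℕ) : List ℕ → Set where
  []  : Fresh used []
  _∷_ : ∀ {x xs} → x ∉ used → Fresh (x ∷ used) xs → Fresh used (x ∷ xs)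

Fresh-++⁻ : ∀ {used} xs {ys} → Fresh used (xs ++ ys) → Fresh used xs × Fresh (xs ʳ++ used) ys
Fresh-++⁻ []       fresh        = [] , fresh
Fresh-++⁻ (x ∷ xs) (x∉ ∷ fresh) = Product.map₁ (x∉ ∷_) (Fresh-++⁻ xs fresh)

Unique⇒Fresh : ∀ {used xs} → Unique xs → (∀ {x} → x ∈ xs → x ∉ used) → Fresh used xs
Unique⇒Fresh []                 _     = []
Unique⇒Fresh (x≢xs ∷ xs-unique) avoid = avoid (here refl) ∷ Unique⇒Fresh xs-unique avoid′
  where
  avoid′ : ∀ {z} → z ∈ _ → z ∉ _
  avoid′ z∈ (here z≡x)     = All.lookup x≢xs z∈ (sym z≡x)
  avoid′ z∈ (there z∈used) = avoid (there z∈) z∈used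

module Completeness {Γ G : Graph} (adjacency : ℕ → List ℕ)
                    (adjacent : ∀ {a b} → E Γ a b → toℕ b ∈ adjacency (toℕ a))
                    (M : OddModel Γ G) where
  open Search {G} (V Γ) adjacency
  open OddModel M

  explore-complete : ∀ {f used a l b} accept →
                     Walk Γ a l b → Fresh used (map toℕ l) → length l < f →
                     T (accept (toℕ b) (map toℕ l ʳ++ used)) →
                     T (explore f used (toℕ a) (parity (length l)) accept)
  explore-complete {zero} _ _ _ () _
  explore-complete {suc f} accept [ e ] [] _ accepted =
    any-complete (adjacent e) (Equivalence.from T-∨ (inj₁ accepted))
  explore-complete {suc f} {used} {l = c ∷ l} accept (e ∷ w) (c∉ ∷ fresh) (s≤s l<f) accepted =
    any-complete (adjacent e) (Equivalence.from T-∨ (inj₂ (Equivalence.from T-∧ (∉⇒∉ᵇ used c∉ , onwards))))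
    where
    onwards : T (explore f (toℕ c ∷ used) (toℕ c) (parity (suc (length l)) ⁻¹) accept)
    onwards = subst (λ p → T (explore f (toℕ c ∷ used) (toℕ c) p accept))
                    (sym (suc-homo-⁻¹ (length l)))
                    (explore-complete accept w fresh l<f accepted)

  edge-found : ∀ {x y} {σ : Vector ℕ (V G)} {used} (accept : ℕ → List ℕ → Bool) →
               E G x y → σ x ≡ toℕ (branch x) → Fresh used (map toℕ (interior x y)) →
               T (accept (toℕ (branch y)) (map toℕ (interior x y) ʳ++ used)) →
               T (explore (suc (V Γ)) used (σ x) 0ℙ accept)
  edge-found {used = used} accept e σx≡ fresh accepted =
    subst₂ (λ a p → T (explore (suc (V Γ)) used a p accept)) (sym σx≡) (interior-even e)
      (explore-complete accept (interior-walk e) fresh (s≤s (Unique⇒length≤ (interior-unique e))) accepted)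

  Agrees : List (Fin (V G)) → Vector ℕ (V G) → Set
  Agrees D σ = ∀ {x} → x ∈ D → σ x ≡ toℕ (branch x)

  place : ∀ {D σ} y → Agrees D σ → Agrees (y ∷ D) (updateAt σ y (const (toℕ (branch y))))
  place {σ = σ} y agrees (here refl) = updateAt-updates y σ
  place {σ = σ} y agrees {x} (there x∈D) with x ≟ y
  ... | yes refl = updateAt-updates y σ
  ... | no x≢y   = trans (updateAt-minimal x y σ x≢y) (agrees x∈D)

  ⟦_⟧ : Atom G → List (Fin (V Γ))
  ⟦ vertex x ⟧   = branch x ∷ []
  ⟦ path x y _ ⟧ = interior x y

  pieces : List (Move G) → List ℕ
  pieces ms = concatMap (map toℕ ∘ ⟦_⟧) (atoms ms)

  run-complete : ∀ {D σ used} ms → Agrees D σ → Valid D ms → Fresh used (pieces ms) → T (run ms σ used)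
  run-complete [] _ [] _ = tt
  run-complete {σ = σ} (grow x y e ∷ ms) agrees (grow x∈D valid) fresh
    with path-fresh , (y∉ ∷ rest-fresh) ← Fresh-++⁻ (map toℕ (interior x y)) fresh =
    edge-found {σ = σ} _ e (agrees x∈D) path-fresh
      (Equivalence.from T-∧ (∉⇒∉ᵇ _ y∉ , run-complete ms (place y agrees) valid rest-fresh))
  run-complete {σ = σ} (reach x y e ∷ ms) agrees (reach x∈D y∈D valid) fresh
    with path-fresh , rest-fresh ← Fresh-++⁻ (map toℕ (interior x y)) fresh =
    edge-found {σ = σ} _ e (agrees x∈D) path-fresh
      (Equivalence.from T-∧ (reached , run-complete ms agrees valid rest-fresh))
    where
    reached : T (toℕ (branch y) ≡ᵇ σ y)
    reached = ≡⇒≡ᵇ _ _ (sym (agrees y∈D))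

  ⟦⟧-unique : ∀ a → Unique ⟦ a ⟧
  ⟦⟧-unique (vertex x)   = [] ∷ []
  ⟦⟧-unique (path x y e) = interior-unique e

  ⟦⟧-disjoint : ∀ {a b} → Separated a b → Disjoint ⟦ a ⟧ ⟦ b ⟧
  ⟦⟧-disjoint {vertex x}     {vertex y}      x≢y (here refl , here eq) = x≢y (branch-injective eq)
  ⟦⟧-disjoint {vertex x}     {path _ _ e}    _   (here refl , z∈)      = branch∉interior e z∈
  ⟦⟧-disjoint {path _ _ e}   {vertex y}      _   (z∈ , here refl)      = branch∉interior e z∈
  ⟦⟧-disjoint {path _ _ e}   {path _ _ e′}   (¬same , ¬swapped) (z∈ , z∈′) =
    Sum.[ ¬same , ¬swapped ] (interior-disjoint e e′ z∈ z∈′)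

  atoms-unique : ∀ {as} → AllPairs Separated as → Unique (concatMap ⟦_⟧ as)
  atoms-unique {as} separated =
    concat⁺ (All-map⁺ (All.universal ⟦⟧-unique as)) (AllPairs-map⁺ (AllPairs.map ⟦⟧-disjoint separated))

  search-complete : ∀ x₀ ms → Valid (x₀ ∷ []) ms → AllPairs Separated (vertex x₀ ∷ atoms ms) →
                    T (search ms)
  search-complete x₀ ms valid separated =
    any-complete (∈-upTo⁺ (toℕ<n (branch x₀))) (run-complete ms placed valid fresh)
    where
    placed : Agrees (x₀ ∷ []) (const (toℕ (branch x₀)))
    placed (here refl) = refl

    all-fresh : Fresh [] (toℕ (branch x₀) ∷ pieces ms)
    all-fresh = Unique⇒Fresh
      (subst Unique (map-concatMap toℕ ⟦_⟧ (vertex x₀ ∷ atoms ms))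
                    (map⁺ toℕ-injective (atoms-unique separated)))
      (λ _ ())

    fresh : Fresh (toℕ (branch x₀) ∷ []) (pieces ms)
    fresh with _ ∷ rest ← all-fresh = rest

-- K₃,₃, Γ₁ and Γ₂

Listed : ∀ {n} → (ℕ → List ℕ) → Fin n × Fin n → Set
Listed adjacency (a , b) = toℕ b ∈ adjacency (toℕ a) × toℕ a ∈ adjacency (toℕ b)

listed? : ∀ {n} adjacency (ab : Fin n × Fin n) → Dec (Listed adjacency ab)
listed? adjacency (a , b) =
  any? (toℕ b ℕ.≟_) (adjacency (toℕ a)) ×-dec any? (toℕ a ℕ.≟_) (adjacency (toℕ b))

fromEdges-adjacent : ∀ {n es} adjacency → All (Listed adjacency) es →
                     ∀ {a b} → E (fromEdges n es) a b → toℕ b ∈ adjacency (toℕ a)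
fromEdges-adjacent _ listed (inj₁ ab∈) = proj₁ (All.lookup listed ab∈)
fromEdges-adjacent _ listed (inj₂ ba∈) = proj₂ (All.lookup listed ba∈)

A B : Fin 3 → Fin 6
A i = i ↑ˡ 3
B j = 3 ↑ʳ j

edge-AB : ∀ i j → E K33 (A i) (B j)
edge-AB i j =
  inj₁ (subst (_< 3) (sym (toℕ-↑ˡ i 3)) (toℕ<n i) , subst (3 ≤_) (sym (toℕ-↑ʳ 3 j)) (m≤m+n 3 (toℕ j)))

edge-BA : ∀ i j → E K33 (B j) (A i)
edge-BA i j = Sum.swap (edge-AB i j)

K33-script : List (Move K33)
K33-script =
    grow  (A (# 0)) (B (# 0)) (edge-AB (# 0) (# 0))
  ∷ grow  (A (# 0)) (B (# 1)) (edge-AB (# 0) (# 1))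
  ∷ grow  (A (# 0)) (B (# 2)) (edge-AB (# 0) (# 2))
  ∷ grow  (B (# 0)) (A (# 1)) (edge-BA (# 1) (# 0))
  ∷ reach (A (# 1)) (B (# 1)) (edge-AB (# 1) (# 1))
  ∷ reach (A (# 1)) (B (# 2)) (edge-AB (# 1) (# 2))
  ∷ grow  (B (# 0)) (A (# 2)) (edge-BA (# 2) (# 0))
  ∷ reach (A (# 2)) (B (# 1)) (edge-AB (# 2) (# 1))
  ∷ reach (A (# 2)) (B (# 2)) (edge-AB (# 2) (# 2))
  ∷ []

K33-script-valid : Valid (A (# 0) ∷ []) K33-script
K33-script-valid = from-yes (valid? (A (# 0) ∷ []) K33-script)

K33-script-separated : AllPairs Separated (vertex (A (# 0)) ∷ atoms K33-script)
K33-script-separated = from-yes (allPairs? separated? (vertex (A (# 0)) ∷ atoms K33-script))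

no-even-K33 : ∀ {n es} adjacency → {True (all? (listed? adjacency) es)} →
              Search.search {K33} n adjacency K33-script ≡ false →
              ¬ ContainsEvenSubdivisionOf (fromEdges n es) K33
no-even-K33 adjacency {listed} not-found H⊆Γ =
  subst T not-found (search-complete (A (# 0)) K33-script K33-script-valid K33-script-separated)
  where
  open Completeness adjacency (fromEdges-adjacent adjacency (toWitness listed))
                    (oddModel Sum.swap K33-loopless H⊆Γ)

-- Vertices a, …, l are 0, …, 11.  no-even-K33 checks that every edge is listed; an extra entry
-- would only enlarge the search.
Γ₁-adjacency : ℕ → List ℕ
Γ₁-adjacency 0  = 1 ∷ 11 ∷ 3 ∷ []
Γ₁-adjacency 1  = 0 ∷ 2 ∷ 6 ∷ []
Γ₁-adjacency 2  = 1 ∷ 3 ∷ 8 ∷ []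
Γ₁-adjacency 3  = 2 ∷ 4 ∷ 0 ∷ []
Γ₁-adjacency 4  = 3 ∷ 5 ∷ 9 ∷ []
Γ₁-adjacency 5  = 4 ∷ 6 ∷ 11 ∷ []
Γ₁-adjacency 6  = 5 ∷ 7 ∷ 1 ∷ []
Γ₁-adjacency 7  = 6 ∷ 8 ∷ 10 ∷ []
Γ₁-adjacency 8  = 7 ∷ 9 ∷ 2 ∷ []
Γ₁-adjacency 9  = 8 ∷ 10 ∷ 4 ∷ []
Γ₁-adjacency 10 = 9 ∷ 11 ∷ 7 ∷ []
Γ₁-adjacency 11 = 10 ∷ 0 ∷ 5 ∷ []
Γ₁-adjacency _  = []

Γ₂-adjacency : ℕ → List ℕ
Γ₂-adjacency 0  = 1 ∷ 11 ∷ 8 ∷ []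
Γ₂-adjacency 1  = 0 ∷ 2 ∷ 5 ∷ []
Γ₂-adjacency 2  = 1 ∷ 3 ∷ 9 ∷ []
Γ₂-adjacency 3  = 2 ∷ 4 ∷ 7 ∷ []
Γ₂-adjacency 4  = 3 ∷ 5 ∷ 11 ∷ []
Γ₂-adjacency 5  = 4 ∷ 6 ∷ 1 ∷ []
Γ₂-adjacency 6  = 5 ∷ 7 ∷ 10 ∷ []
Γ₂-adjacency 7  = 6 ∷ 8 ∷ 3 ∷ []
Γ₂-adjacency 8  = 7 ∷ 9 ∷ 0 ∷ []
Γ₂-adjacency 9  = 8 ∷ 10 ∷ 2 ∷ []
Γ₂-adjacency 10 = 9 ∷ 11 ∷ 6 ∷ []
Γ₂-adjacency 11 = 10 ∷ 0 ∷ 4 ∷ []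
Γ₂-adjacency _  = []

mainTheorem6 : ¬ ContainsEvenSubdivisionOf Γ₁ K33 × ¬ ContainsEvenSubdivisionOf Γ₂ K33
mainTheorem6 =
  no-even-K33 Γ₁-adjacency refl , no-even-K33 Γ₂-adjacency refl
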